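{- Let $\mathsf{L}$ be the Burrows–Wheeler transform of a nullterminated string of length $n$, with LF-mapping $\mathsf{LF}$, and let $\mathsf{cntL},\mathsf{cntF}\in\{0,1\}^n$ be two bitvectors. Then the following hold for the generalized LF-mapping $\mathsf{LF}^{\mathsf{cntL}}_{\mathsf{cntF}}$ of $(\mathsf{L},\mathsf{cntL},\mathsf{cntF})$: 1. If $\mathsf{cntF}[i]=\mathsf{cntL}[i]=1$ for all $i\in[1,n]$, then $\mathsf{LF}^{\mathsf{cntL}}_{\mathsf{cntF}}[i]=\mathsf{LF}[i]$ for all $i\in[1,n]$. 2. Suppose $\mathsf{LF}^{\mathsf{cntL}}_{\mathsf{cntF}}[j]=\mathsf{LF}[j]$ for all $j$ with $\mathsf{cntL}[j]=1$, and let $i$ be an index with $\mathsf{cntL}[i]=\mathsf{cntF}[\mathsf{LF}[i]]=1$. Define $\widetilde{\mathsf{cntL}}[j]:=\mathsf{cntL}[j]\cdot[j\neq i]$ and $\widetilde{\mathsf{cntF}}[j]:=\mathsf{cntF}[j]\cdot[j\neq \mathsf{LF}[i]]$ for $j\in[1,n]$. Then $\mathsf{LF}^{\widetilde{\mathsf{cntL}}}_{\widetilde{\mathsf{cntF}}}[j]=\mathsf{LF}[j]$ for all $j$ with $\widetilde{\mathsf{cntL}}[j]=1$ (here the generalized mapping is taken with respect to the same string $\mathsf{L}$). 3. Let $i$ be an index with $\mathsf{cntL}[i]=\mathsf{cntF}[i]=0$. Define, for $j\in[1,n-1]$, $\widetilde{\mathsf{cntL}}[j]:=\mathsf{cntL}[j+[j\ge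 i]]$, $\widetilde{\mathsf{cntF}}[j]:=\mathsf{cntF}[j+[j\ge i]]$ and $\widetilde{\mathsf{L}}[j]:=\mathsf{L}[j+[j\ge i]]$, and let $\widetilde{\mathsf{LF}}^{\widetilde{\mathsf{cntL}}}_{\widetilde{\mathsf{cntF}}}$ be the generalized LF-mapping of $(\widetilde{\mathsf{L}},\widetilde{\mathsf{cntL}},\widetilde{\mathsf{cntF}})$. Then for all $j\in[1,n-1]$: $$\widetilde{\mathsf{LF}}^{\widetilde{\mathsf{cntL}}}_{\widetilde{\mathsf{cntF}}}[j]=\mathsf{LF}^{\mathsf{cntL}}_{\mathsf{cntF}}[j+[j\ge i]]-\big[\mathsf{LF}^{\mathsf{cntL}}_{\mathsf{cntF}}[j+[j\ge i]]\ge i\big].$$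
   Context: Indices start at 1. $\Sigma$ is a totally ordered alphabet; a string $S$ of length $n$ is nullterminated if its last character is the smallest character $\$\in\Sigma$ and $\$$ occurs nowhere else. The suffix array $\mathsf{SA}$ of $S$ is the permutation of $[1,n]$ with $S[\mathsf{SA}[1]..n]<_{lex}S[\mathsf{SA}[2]..n]<_{lex}\dots$. The Burrows–Wheeler transform (BWT) is the string $\mathsf{L}$ of length $n$ with $\mathsf{L}[i]=S[\mathsf{SA}[i]-1]$ if $\mathsf{SA}[i]>1$ and $\mathsf{L}[i]=\$$ otherwise. For a string $X$, $\mathsf{C}_X[c]$ is the number of positions of $X$ holding a character smaller than $c$, and $\mathsf{rank}_X(c,i)$ is the number of occurrences of $c$ in $X[1..i]$. The LF-mapping is $\mathsf{LF}[i]:=\mathsf{C}_{\mathsf{L}}[\mathsf{L}[i]]+\mathsf{rank}_{\mathsf{L}}(\mathsf{L}[i],i)$. $[P]$ denotes the indicator of predicate $P$ (1 if true, 0 otherwise). For a bitvector $b$, $\mathsf{select}_b(1,t)$ is the position of the $t$-th 1 in $b$. For any string $X$ of length $m$ and bitvectors $a,b$ of length $m$, the generalized LF-mapping is $$\mathsf{LF}^{a}_{b}[i]:=\mathsf{select}_{b}\Big(1,\ \sum_{k=1}^{m}a[k]\cdot[X[k]<X[i]]+\sum_{k=1}^{i}a[k]\cdot[X[k]=X[i]]\Big).$$ -}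

module Defs where

open import Data.Nat using (ℕ; zero; suc; _+_; _∸_; _≤_; _<_; _≤ᵇ_; _≡ᵇ_)
open import Data.Bool using (Bool; true; false; if_then_else_; _∧_; not)
open import Data.Maybe using (Maybe; just; nothing)
open import Data.List using (List; map; upTo)
open import Data.Product using (Σ; ∃; _×_)
open import Relation.Nullary using (¬_)
open import Relation.Nullary.Decidable using (⌊_⌋)
open import Relation.Binary.PropositionalEquality using (_≡_; _≢_)
open import Relation.Binary.Structures using (IsStrictTotalOrder)
open import Data.List.Relation.Binary.Lex.Strict using (Lex-<)

-- Conventions: strings and bitvectors are functions ℕ → A / ℕ → Bool,
-- of which only positions 1..m (1-based, as in the paper) are used.
-- A bit is 1 iff it is 'true'.

[_] : Bool → ℕ
[ b ] = if b then 1 else 0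

count : (ℕ → Bool) → ℕ → ℕ
count f zero    = 0
count f (suc m) = count f m + [ f (suc m) ]

select : (ℕ → Bool) → ℕ → ℕ → Maybe ℕ
select b zero    t = nothing
select b (suc m) t with select b m t
... | just p  = just p
... | nothing = if b (suc m) ∧ (count b (suc m) ≡ᵇ t) then just (suc m) else nothing

module _ {A : Set} {_≺_ : A → A → Set} (sto : IsStrictTotalOrder _≡_ _≺_) where
  open IsStrictTotalOrder sto using (_<?_; _≟_)

  Cnt : (ℕ → A) → ℕ → A → ℕ
  Cnt X m c = count (λ k → ⌊ X k <? c ⌋) m

  rank : (ℕ → A) → A → ℕ → ℕ
  rank X c i = count (λ k → ⌊ X k ≟ c ⌋) i

  LF : (ℕ → A) → ℕ → ℕ → ℕ
  LF L m i = Cnt L m (L i) + rank L (L i) i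

  GenLF : (ℕ → A) → (ℕ → Bool) → (ℕ → Bool) → ℕ → ℕ → Maybe ℕ
  GenLF X a b m i =
    select b m ( count (λ k → a k ∧ ⌊ X k <? X i ⌋) m
               + count (λ k → a k ∧ ⌊ X k ≟ X i ⌋) i )

  suffix : (ℕ → A) → ℕ → ℕ → List A
  suffix S n i = map (λ t → S (i + t)) (upTo (suc n ∸ i))

  SufLt : (ℕ → A) → ℕ → ℕ → ℕ → Set
  SufLt S n i j = Lex-< _≡_ _≺_ (suffix S n i) (suffix S n j)

  Nullterminated : A → (ℕ → A) → ℕ → Set
  Nullterminated $ S n = (1 ≤ n) × (S n ≡ $) × (∀ k → 1 ≤ k → k < n → S k ≢ $)

  IsSuffixArray : (ℕ → A) → ℕ → (ℕ → ℕ) → Set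
  IsSuffixArray S n SA =
      (∀ k → 1 ≤ k → k ≤ n → (1 ≤ SA k) × (SA k ≤ n))
    × (∀ k l → 1 ≤ k → k ≤ n → 1 ≤ l → l ≤ n → SA k ≡ SA l → k ≡ l)
    × (∀ p → 1 ≤ p → p ≤ n → ∃ λ k → (1 ≤ k) × (k ≤ n) × (SA k ≡ p))
    × (∀ k → 1 ≤ k → k < n → SufLt S n (SA k) (SA (suc k)))

  BWT : A → (ℕ → A) → (ℕ → ℕ) → ℕ → A
  BWT $ S SA k = if 1 <ᵇ' SA k then S (SA k ∸ 1) else $
    where
    _<ᵇ'_ : ℕ → ℕ → Bool
    x <ᵇ' y = suc x ≤ᵇ y

clearBit : (ℕ → Bool) → ℕ → (ℕ → Bool)
clearBit a i j = a j ∧ not (j ≡ᵇ i)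

skip : ℕ → ℕ → ℕ
skip i j = j + [ i ≤ᵇ j ]

-- GenLF^a_b[i] selects the b-marked position whose rank among the b-marked positions is the
-- number of a-marked positions k with (L[k], k) lexicographically at most (L[i], i); LF[i] is
-- that number with every position marked, so LF maps this order strictly monotonically into
-- [1, n].  Hence (1) with all bits set both sides coincide; (2) unmarking i in cntL and LF[i] in
-- cntF lowers both ranks by one exactly for the j after i in the order, which are the j with
-- LF[j] > LF[i], and leaves the others unchanged; (3) deleting a position marked in neither
-- bitvector renumbers positions without changing any count.
module Submission where

open import Defs
open import Data.Nat using (ℕ; zero; suc; _+_; _∸_; _≤_; _<_; _≤ᵇ_; _≡ᵇ_; z≤n; s≤s; _≤?_)
open import Data.Nat.Properties
open import Algebra.Properties.CommutativeSemigroup +-commutativeSemigroup using (interchange)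
open import Data.Bool using (Bool; true; false; _∧_; not; if_then_else_)
open import Data.Bool.Properties using (∧-identityʳ; ∧-zeroʳ; ∧-conicalˡ; ∧-conicalʳ; T-≡)
open import Data.Maybe using (just; nothing)
import Data.Maybe as Maybe
open import Data.Product using (_×_; _,_; proj₁; proj₂)
open import Data.Sum using (_⊎_; inj₁; inj₂)
open import Function using (_∘_; Equivalence)
open import Relation.Nullary using (¬_; Dec; yes; no; contradiction)
open import Relation.Nullary.Decidable using (⌊_⌋; dec-true; dec-false; isYes≗does)
open import Relation.Binary.PropositionalEquality hiding ([_])
open import Relation.Binary.Structures using (IsStrictTotalOrder)
open import Relation.Binary.Definitions using (tri<; tri≈; tri>)

isYes-true : ∀ {P : Set} (d : Dec P) → P → ⌊ d ⌋ ≡ true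
isYes-true d p = trans (isYes≗does d) (dec-true d p)

isYes-false : ∀ {P : Set} (d : Dec P) → ¬ P → ⌊ d ⌋ ≡ false
isYes-false d ¬p = trans (isYes≗does d) (dec-false d ¬p)

clearBit-≢ : ∀ a {i k} → k ≢ i → clearBit a i k ≡ a k
clearBit-≢ a {i} {k} k≢i = trans (cong (λ e → a k ∧ not e) (dec-false (k ≟ i) k≢i)) (∧-identityʳ (a k))

clearBit-self : ∀ a i → clearBit a i i ≡ false
clearBit-self a i = trans (cong (λ e → a i ∧ not e) (dec-true (i ≟ i) refl)) (∧-zeroʳ (a i))

skip-≥ : ∀ {i j} → i ≤ j → skip i j ≡ suc j
skip-≥ {i} {j} i≤j = trans (cong (λ e → j + [ e ]) (dec-true (i ≤? j) i≤j)) (+-comm j 1)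

skip-< : ∀ {i j} → j < i → skip i j ≡ j
skip-< {i} {j} j<i = trans (cong (λ e → j + [ e ]) (dec-false (i ≤? j) (<⇒≱ j<i))) (+-identityʳ j)

skip-≤ : ∀ i j → skip i j ≤ suc j
skip-≤ i j with i ≤? j
... | yes i≤j = ≤-reflexive (skip-≥ i≤j)
... | no i≰j = ≤-trans (≤-reflexive (skip-< (≰⇒> i≰j))) (n≤1+n j)

unskip : ℕ → ℕ → ℕ
unskip i p = p ∸ [ i ≤ᵇ p ]

unskip-< : ∀ {i p} → p < i → unskip i p ≡ p
unskip-< {i} {p} p<i = cong (λ e → p ∸ [ e ]) (dec-false (i ≤? p) (<⇒≱ p<i))

unskip-≥ : ∀ {i q} → i ≤ suc q → unskip i (suc q) ≡ q
unskip-≥ {i} {q} i≤1+q = cong (λ e → suc q ∸ [ e ]) (dec-true (i ≤? suc q) i≤1+q)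

unskip-inverts-skip : ∀ {i p m} → 1 ≤ i → i ≤ suc m → 1 ≤ p → p ≤ suc m → p ≢ i
  → (1 ≤ unskip i p) × (unskip i p ≤ m) × (skip i (unskip i p) ≡ p)
unskip-inverts-skip {i} {p} 1≤i i≤1+m 1≤p p≤1+m p≢i with i ≤? p
... | no i≰p rewrite unskip-< (≰⇒> i≰p) = 1≤p , ≤-pred (≤-trans (≰⇒> i≰p) i≤1+m) , skip-< (≰⇒> i≰p)
... | yes i≤p with ≤∧≢⇒< i≤p (p≢i ∘ sym)
...   | s≤s i≤q rewrite unskip-≥ i≤p = ≤-trans 1≤i i≤q , ≤-pred p≤1+m , skip-≥ i≤q

count-cong : ∀ {f g} m → (∀ k → 1 ≤ k → k ≤ m → f k ≡ g k) → count f m ≡ count g m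
count-cong zero    f≗g = refl
count-cong (suc m) f≗g =
  cong₂ _+_ (count-cong m λ k 1≤k k≤m → f≗g k 1≤k (m≤n⇒m≤1+n k≤m))
            (cong [_] (f≗g (suc m) (s≤s z≤n) ≤-refl))

count-all : ∀ m → count (λ _ → true) m ≡ m
count-all zero    = refl
count-all (suc m) = trans (cong (_+ 1) (count-all m)) (+-comm m 1)

count-mono : ∀ f {i m} → i ≤ m → count f i ≤ count f m
count-mono f {m = zero}  z≤n  = ≤-refl
count-mono f {m = suc m} i≤1+m with m≤n⇒m<n∨m≡n i≤1+m
... | inj₁ (s≤s i≤m) = ≤-trans (count-mono f i≤m) (m≤m+n (count f m) _)
... | inj₂ refl      = ≤-refl

count-< : ∀ f {i j} → f j ≡ true → i < j → count f i < count f j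
count-< f {i} {suc j} fj≡true (s≤s i≤j) rewrite fj≡true =
  ≤-trans (s≤s (count-mono f i≤j)) (≤-reflexive (+-comm 1 (count f j)))

count-+-≤ : ∀ f g h → (∀ k → [ f k ] + [ g k ] ≤ [ h k ]) → ∀ m → count f m + count g m ≤ count h m
count-+-≤ f g h pointwise zero    = z≤n
count-+-≤ f g h pointwise (suc m) =
  ≤-trans (≤-reflexive (interchange (count f m) [ f (suc m) ] (count g m) [ g (suc m) ]))
          (+-mono-≤ (count-+-≤ f g h pointwise m) (pointwise (suc m)))

count-agree : ∀ {f g i} m → (∀ k → k ≢ i → f k ≡ g k) → f i ≡ g i ⊎ m < i → count f m ≡ count g m
count-agree {f} {g} {i} m agree at-i = count-cong m pointwise
  where
  in-range : f i ≡ g i ⊎ m < i → i ≤ m → f i ≡ g i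
  in-range (inj₁ fi≡gi) _   = fi≡gi
  in-range (inj₂ m<i)   i≤m = contradiction i≤m (<⇒≱ m<i)

  pointwise : ∀ k → 1 ≤ k → k ≤ m → f k ≡ g k
  pointwise k _ k≤m with k ≟ i
  ... | no k≢i   = agree k k≢i
  ... | yes refl = in-range at-i k≤m

count-remove : ∀ {f g i} m → (∀ k → k ≢ i → f k ≡ g k) → f i ≡ true → g i ≡ false
  → 1 ≤ i → i ≤ m → count f m ≡ suc (count g m)
count-remove zero _ _ _ (s≤s _) ()
count-remove {f} {g} {i} (suc m) agree fi gi 1≤i i≤1+m with m≤n⇒m<n∨m≡n i≤1+m
... | inj₁ (s≤s i≤m) =
  cong₂ _+_ (count-remove m agree fi gi 1≤i i≤m) (cong [_] (agree (suc m) (<⇒≢ (s≤s i≤m) ∘ sym)))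
... | inj₂ refl = begin
  count f m + [ f i ]  ≡⟨ cong₂ (λ c e → c + [ e ]) (count-agree m agree (inj₂ ≤-refl)) fi ⟩
  count g m + 1        ≡⟨ +-comm (count g m) 1 ⟩
  suc (count g m)      ≡⟨ cong suc (sym (+-identityʳ (count g m))) ⟩
  suc (count g m + 0)  ≡⟨ cong (λ e → suc (count g m + [ e ])) (sym gi) ⟩
  suc (count g i)      ∎
  where open ≡-Reasoning

count-clearBit-∧ : ∀ a (P : ℕ → Bool) {i} m → a i ≡ true → P i ≡ true → 1 ≤ i → i ≤ m
  → count (λ k → a k ∧ P k) m ≡ suc (count (λ k → clearBit a i k ∧ P k) m)
count-clearBit-∧ a P {i} m ai Pi =
  count-remove m (λ k k≢i → cong (_∧ P k) (sym (clearBit-≢ a k≢i)))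
    (cong₂ _∧_ ai Pi) (cong (_∧ P i) (clearBit-self a i))

count-clearBit-∧-unchanged : ∀ a (P : ℕ → Bool) {i} m → P i ≡ false ⊎ m < i
  → count (λ k → clearBit a i k ∧ P k) m ≡ count (λ k → a k ∧ P k) m
count-clearBit-∧-unchanged a P {i} m unseen =
  count-agree m (λ k k≢i → cong (_∧ P k) (clearBit-≢ a k≢i)) (at-i unseen)
  where
  ∧-P-false : P i ≡ false → ∀ x → x ∧ P i ≡ false
  ∧-P-false Pi x = trans (cong (x ∧_) Pi) (∧-zeroʳ x)

  at-i : P i ≡ false ⊎ m < i → clearBit a i i ∧ P i ≡ a i ∧ P i ⊎ m < i
  at-i (inj₁ Pi)  = inj₁ (trans (∧-P-false Pi _) (sym (∧-P-false Pi _)))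
  at-i (inj₂ m<i) = inj₂ m<i

count-step : ∀ f {m n} → n ≡ suc m → count f n ≡ count f m + [ f n ]
count-step f refl = refl

count-skip-step : ∀ f {i} m → f i ≡ false
  → count f (skip i (suc m)) ≡ count f (skip i m) + [ f (skip i (suc m)) ]
count-skip-step f {i} m fi with <-cmp i (suc m)
... | tri< (s≤s i≤m) _ _ = count-step f (trans (skip-≥ (m≤n⇒m≤1+n i≤m)) (cong suc (sym (skip-≥ i≤m))))
... | tri> _ _ 1+m<i     = count-step f (trans (skip-< 1+m<i) (cong suc (sym (skip-< (<-trans (n<1+n m) 1+m<i)))))
... | tri≈ _ refl _      = begin
  count f (skip i (suc m))                     ≡⟨ cong (count f) (skip-≥ ≤-refl) ⟩
  count f m + [ f i ] + [ f (suc i) ]          ≡⟨ cong (λ e → count f m + [ e ] + [ f (suc i) ]) fi ⟩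
  count f m + 0 + [ f (suc i) ]                ≡⟨ cong (_+ [ f (suc i) ]) (+-identityʳ (count f m)) ⟩
  count f m + [ f (suc i) ]                    ≡⟨ cong₂ (λ p q → count f p + [ f q ])
                                                        (sym (skip-< (n<1+n m))) (sym (skip-≥ ≤-refl)) ⟩
  count f (skip i m) + [ f (skip i (suc m)) ]  ∎
  where open ≡-Reasoning

count-skip : ∀ f {i} m → 1 ≤ i → f i ≡ false → count (λ k → f (skip i k)) m ≡ count f (skip i m)
count-skip f zero    1≤i fi = sym (cong (count f) (skip-< 1≤i))
count-skip f {i} (suc m) 1≤i fi =
  trans (cong (_+ [ f (skip i (suc m)) ]) (count-skip f m 1≤i fi)) (sym (count-skip-step f m fi))

count-skip-suc : ∀ f {i} m → 1 ≤ i → i ≤ suc m → f i ≡ false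
  → count (λ k → f (skip i k)) m ≡ count f (suc m)
count-skip-suc f {i} m 1≤i i≤1+m fi =
  trans (count-skip f m 1≤i fi) (skipped-all (m≤n⇒m<n∨m≡n i≤1+m))
  where
  skipped-all : i < suc m ⊎ i ≡ suc m → count f (skip i m) ≡ count f (suc m)
  skipped-all (inj₁ (s≤s i≤m)) = cong (count f) (skip-≥ i≤m)
  skipped-all (inj₂ refl) rewrite skip-< (n<1+n m) | fi = sym (+-identityʳ (count f m))

record IsSelect (b : ℕ → Bool) (m t p : ℕ) : Set where
  field
    positive : 1 ≤ p
    bounded  : p ≤ m
    marked   : b p ≡ true
    counted  : count b p ≡ t

open IsSelect

isSelect-resize : ∀ {b m m′ t p} → p ≤ m′ → IsSelect b m t p → IsSelect b m′ t p
isSelect-resize p≤m′ s = record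
  { positive = positive s
  ; bounded  = p≤m′
  ; marked   = marked s
  ; counted  = counted s
  }

select-sound : ∀ b m {t p} → select b m t ≡ just p → IsSelect b m t p
select-sound b (suc m) {t} eq with select b m t in eqₘ
... | just q with eq
...   | refl = isSelect-resize (m≤n⇒m≤1+n (bounded s)) s
  where s = select-sound b m eqₘ
select-sound b (suc m) {t} eq | nothing with b (suc m) ∧ (count b (suc m) ≡ᵇ t) in found | eq
...   | true | refl = record
  { positive = s≤s z≤n
  ; bounded  = ≤-refl
  ; marked   = ∧-conicalˡ _ _ found
  ; counted  = ≡ᵇ⇒≡ _ _ (Equivalence.from T-≡ (∧-conicalʳ _ _ found))
  }

select-complete : ∀ b m {t p} → IsSelect b m t p → select b m t ≡ just p
select-complete b zero s = contradiction (≤-trans (positive s) (bounded s)) λ ()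
select-complete b (suc m) {t} s with select b m t in eqₘ | m≤n⇒m<n∨m≡n (bounded s)
... | just q  | inj₁ (s≤s p≤m) = trans (sym eqₘ) (select-complete b m (isSelect-resize p≤m s))
... | nothing | inj₁ (s≤s p≤m) =
  contradiction (trans (sym eqₘ) (select-complete b m (isSelect-resize p≤m s))) λ ()
... | nothing | inj₂ refl = cong (λ c → if c then just (suc m) else nothing)
  (cong₂ _∧_ (marked s) (dec-true (count b (suc m) ≟ t) (counted s)))
... | just q  | inj₂ refl =
  contradiction (trans (counted sq) (sym (counted s))) (<⇒≢ (count-< b (marked s) (s≤s (bounded sq))))
  where sq = select-sound b m eqₘ

select-allMarked : ∀ {b m p} → (∀ k → 1 ≤ k → k ≤ m → b k ≡ true) → 1 ≤ p → p ≤ m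
  → select b m p ≡ just p
select-allMarked {b} {m} {p} all 1≤p p≤m = select-complete b m record
  { positive = 1≤p
  ; bounded  = p≤m
  ; marked   = all p 1≤p p≤m
  ; counted  = trans (count-cong p λ k 1≤k k≤p → all k 1≤k (≤-trans k≤p p≤m)) (count-all p)
  }

isSelect-clearBit-below : ∀ {b m t p q} → q < p → 1 ≤ q → b q ≡ true
  → IsSelect b m (suc t) p → IsSelect (clearBit b q) m t p
isSelect-clearBit-below {b} {p = p} {q} q<p 1≤q bq s = record
  { positive = positive s
  ; bounded  = bounded s
  ; marked   = trans (clearBit-≢ b (<⇒≢ q<p ∘ sym)) (marked s)
  ; counted  = suc-injective (trans (sym removed) (counted s))
  }
  where
  removed : count b p ≡ suc (count (clearBit b q) p)
  removed = count-remove p (λ k k≢q → sym (clearBit-≢ b k≢q)) bq (clearBit-self b q) 1≤q (<⇒≤ q<p)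

isSelect-clearBit-above : ∀ {b m t p q} → p < q → IsSelect b m t p → IsSelect (clearBit b q) m t p
isSelect-clearBit-above {b} {p = p} p<q s = record
  { positive = positive s
  ; bounded  = bounded s
  ; marked   = trans (clearBit-≢ b (<⇒≢ p<q)) (marked s)
  ; counted  = trans (count-agree p (λ k k≢q → clearBit-≢ b k≢q) (inj₂ p<q)) (counted s)
  }

isSelect-skip : ∀ {b i m t q} → 1 ≤ i → b i ≡ false
  → IsSelect (λ k → b (skip i k)) m t q → IsSelect b (suc m) t (skip i q)
isSelect-skip {b} {i} {q = q} 1≤i bi s = record
  { positive = ≤-trans (positive s) (m≤m+n q _)
  ; bounded  = ≤-trans (skip-≤ i q) (s≤s (bounded s))
  ; marked   = marked s
  ; counted  = trans (sym (count-skip b q 1≤i bi)) (counted s)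
  }

isSelect-unskip : ∀ {b i m t p} → 1 ≤ i → i ≤ suc m → b i ≡ false
  → IsSelect b (suc m) t p → IsSelect (λ k → b (skip i k)) m t (unskip i p)
isSelect-unskip {b} {i} {p = p} 1≤i i≤1+m bi s
  with unskip-inverts-skip 1≤i i≤1+m (positive s) (bounded s) p≢i
  where
  p≢i : p ≢ i
  p≢i refl = contradiction (trans (sym (marked s)) bi) λ ()
... | 1≤q , q≤m , skip-q≡p = record
  { positive = 1≤q
  ; bounded  = q≤m
  ; marked   = trans (cong b skip-q≡p) (marked s)
  ; counted  = trans (count-skip b (unskip i p) 1≤i bi) (trans (cong (count b) skip-q≡p) (counted s))
  }

select-skip : ∀ b {i} m t → 1 ≤ i → i ≤ suc m → b i ≡ false
  → select (λ k → b (skip i k)) m t ≡ Maybe.map (unskip i) (select b (suc m) t)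
select-skip b {i} m t 1≤i i≤1+m bi with select b (suc m) t in eq
... | just p = select-complete _ m (isSelect-unskip 1≤i i≤1+m bi (select-sound b (suc m) eq))
... | nothing with select (λ k → b (skip i k)) m t in eq′
...   | nothing = refl
...   | just q  =
  contradiction (trans (sym eq) (select-complete b (suc m) (isSelect-skip 1≤i bi (select-sound _ m eq′)))) λ ()

module _ {A : Set} {_≺_ : A → A → Set} (sto : IsStrictTotalOrder _≡_ _≺_) where
  open IsStrictTotalOrder sto using (compare; irrefl; asym)
    renaming (_<?_ to _<A?_; _≟_ to _≟A_; trans to ≺-trans)

  -- GenLF sto X a b m i unfolds to select b m (markedRank X m a i),
  -- and LF sto L n i to markedRank L n (λ _ → true) i.
  markedRank : (ℕ → A) → ℕ → (ℕ → Bool) → ℕ → ℕ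
  markedRank X m a i = count (λ k → a k ∧ ⌊ X k <A? X i ⌋) m + count (λ k → a k ∧ ⌊ X k ≟A X i ⌋) i

  ≺⊎≡-exclusive : ∀ x c → [ ⌊ x <A? c ⌋ ] + [ ⌊ x ≟A c ⌋ ] ≤ 1
  ≺⊎≡-exclusive x c with x <A? c | x ≟A c
  ... | yes x≺c | yes x≡c = contradiction x≺c (irrefl x≡c)
  ... | yes _   | no _    = ≤-refl
  ... | no _    | yes _   = ≤-refl
  ... | no _    | no _    = z≤n

  ≺⊎≡-≺-trans : ∀ {c d} → c ≺ d → ∀ x → [ ⌊ x <A? c ⌋ ] + [ ⌊ x ≟A c ⌋ ] ≤ [ ⌊ x <A? d ⌋ ]
  ≺⊎≡-≺-trans {c} {d} c≺d x with x <A? c | x ≟A c | x <A? d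
  ... | yes x≺c | yes x≡c  | _       = contradiction x≺c (irrefl x≡c)
  ... | yes _   | no _     | yes _   = ≤-refl
  ... | yes x≺c | no _     | no x⊀d  = contradiction (≺-trans x≺c c≺d) x⊀d
  ... | no _    | yes _    | yes _   = ≤-refl
  ... | no _    | yes refl | no x⊀d  = contradiction c≺d x⊀d
  ... | no _    | no _     | _       = z≤n

  module _ (L : ℕ → A) (n : ℕ) where

    Before : ℕ → ℕ → Set
    Before i j = L i ≺ L j ⊎ (L i ≡ L j × i < j)

    before-total : ∀ {i j} → i ≢ j → Before i j ⊎ Before j i
    before-total {i} {j} i≢j with compare (L i) (L j)
    ... | tri< Li≺Lj _ _ = inj₁ (inj₁ Li≺Lj)
    ... | tri> _ _ Lj≺Li = inj₂ (inj₁ Lj≺Li)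
    ... | tri≈ _ Li≡Lj _ with <-cmp i j
    ...   | tri< i<j _ _ = inj₁ (inj₂ (Li≡Lj , i<j))
    ...   | tri≈ _ i≡j _ = contradiction i≡j i≢j
    ...   | tri> _ _ j<i = inj₂ (inj₂ (sym Li≡Lj , j<i))

    rank-self-positive : ∀ {i} → 1 ≤ i → 1 ≤ rank sto L (L i) i
    rank-self-positive {i} = count-< (λ k → ⌊ L k ≟A L i ⌋) (isYes-true (L i ≟A L i) refl)

    LF-positive : ∀ {i} → 1 ≤ i → 1 ≤ LF sto L n i
    LF-positive {i} 1≤i = ≤-trans (rank-self-positive 1≤i) (m≤n+m _ (Cnt sto L n (L i)))

    LF-≤ : ∀ {i} → i ≤ n → LF sto L n i ≤ n
    LF-≤ {i} i≤n = begin
      Cnt sto L n (L i) + rank sto L (L i) i  ≤⟨ +-monoʳ-≤ (Cnt sto L n (L i)) (count-mono _ i≤n) ⟩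
      Cnt sto L n (L i) + rank sto L (L i) n  ≤⟨ count-+-≤ _ _ _ (λ k → ≺⊎≡-exclusive (L k) (L i)) n ⟩
      count (λ _ → true) n                    ≡⟨ count-all n ⟩
      n                                       ∎
      where open ≤-Reasoning

    LF-monotone : ∀ {i j} → i ≤ n → 1 ≤ j → Before i j → LF sto L n i < LF sto L n j
    LF-monotone {i} {j} i≤n 1≤j (inj₁ Li≺Lj) = begin-strict
      Cnt sto L n (L i) + rank sto L (L i) i  ≤⟨ +-monoʳ-≤ (Cnt sto L n (L i)) (count-mono _ i≤n) ⟩
      Cnt sto L n (L i) + rank sto L (L i) n  ≤⟨ count-+-≤ _ _ _ (≺⊎≡-≺-trans Li≺Lj ∘ L) n ⟩
      Cnt sto L n (L j)                       <⟨ m<m+n _ (rank-self-positive 1≤j) ⟩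
      Cnt sto L n (L j) + rank sto L (L j) j  ∎
      where open ≤-Reasoning
    LF-monotone {i} {j} i≤n 1≤j (inj₂ (Li≡Lj , i<j)) =
      subst (λ c → Cnt sto L n c + rank sto L c i < LF sto L n j) (sym Li≡Lj)
        (+-monoʳ-< (Cnt sto L n (L j)) (count-< _ (isYes-true (L j ≟A L j) refl) i<j))

    markedRank-allMarked : ∀ {a i} → (∀ k → 1 ≤ k → k ≤ n → a k ≡ true) → i ≤ n
      → markedRank L n a i ≡ LF sto L n i
    markedRank-allMarked {a} {i} all i≤n = cong₂ _+_
      (count-cong n λ k 1≤k k≤n → cong (_∧ _) (all k 1≤k k≤n))
      (count-cong i λ k 1≤k k≤i → cong (_∧ _) (all k 1≤k (≤-trans k≤i i≤n)))

    markedRank-clearBit-before : ∀ {a i j} → a i ≡ true → 1 ≤ i → i ≤ n → Before i j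
      → markedRank L n a j ≡ suc (markedRank L n (clearBit a i) j)
    markedRank-clearBit-before {a} {i} {j} ai 1≤i i≤n (inj₁ Li≺Lj) = cong₂ _+_
      (count-clearBit-∧ a _ n ai (isYes-true (L i <A? L j) Li≺Lj) 1≤i i≤n)
      (sym (count-clearBit-∧-unchanged a _ j (inj₁ (isYes-false (L i ≟A L j) (λ Li≡Lj → irrefl Li≡Lj Li≺Lj)))))
    markedRank-clearBit-before {a} {i} {j} ai 1≤i i≤n (inj₂ (Li≡Lj , i<j)) = trans (cong₂ _+_
      (sym (count-clearBit-∧-unchanged a _ n (inj₁ (isYes-false (L i <A? L j) (irrefl Li≡Lj)))))
      (count-clearBit-∧ a _ j ai (isYes-true (L i ≟A L j) Li≡Lj) 1≤i (<⇒≤ i<j)))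
      (+-suc _ _)

    markedRank-clearBit-after : ∀ {a i j} → Before j i
      → markedRank L n (clearBit a i) j ≡ markedRank L n a j
    markedRank-clearBit-after {a} {i} {j} (inj₁ Lj≺Li) = cong₂ _+_
      (count-clearBit-∧-unchanged a _ n (inj₁ (isYes-false (L i <A? L j) (asym Lj≺Li))))
      (count-clearBit-∧-unchanged a _ j (inj₁ (isYes-false (L i ≟A L j) (λ Li≡Lj → irrefl (sym Li≡Lj) Lj≺Li))))
    markedRank-clearBit-after {a} {i} {j} (inj₂ (Lj≡Li , j<i)) = cong₂ _+_
      (count-clearBit-∧-unchanged a _ n (inj₁ (isYes-false (L i <A? L j) (irrefl (sym Lj≡Li)))))
      (count-clearBit-∧-unchanged a _ j (inj₂ j<i))

    GenLF-allMarked≡LF : ∀ {cntL cntF} → (∀ i → 1 ≤ i → i ≤ n → cntL i ≡ true × cntF i ≡ true)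
      → ∀ i → 1 ≤ i → i ≤ n → GenLF sto L cntL cntF n i ≡ just (LF sto L n i)
    GenLF-allMarked≡LF {cntL} {cntF} all i 1≤i i≤n =
      trans (cong (select cntF n) (markedRank-allMarked (λ k 1≤k k≤n → proj₁ (all k 1≤k k≤n)) i≤n))
            (select-allMarked (λ k 1≤k k≤n → proj₂ (all k 1≤k k≤n)) (LF-positive 1≤i) (LF-≤ i≤n))

    GenLF≡LF-clearBit : ∀ {cntL cntF}
      → (∀ j → 1 ≤ j → j ≤ n → cntL j ≡ true → GenLF sto L cntL cntF n j ≡ just (LF sto L n j))
      → ∀ i → 1 ≤ i → i ≤ n → cntL i ≡ true → cntF (LF sto L n i) ≡ true
      → ∀ j → 1 ≤ j → j ≤ n → clearBit cntL i j ≡ true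
      → GenLF sto L (clearBit cntL i) (clearBit cntF (LF sto L n i)) n j ≡ just (LF sto L n j)
    GenLF≡LF-clearBit {cntL} {cntF} correct i 1≤i i≤n cLi cFi j 1≤j j≤n clj =
      select-complete _ n (unmark (before-total i≢j))
      where
      i≢j : i ≢ j
      i≢j refl = contradiction (trans (sym clj) (clearBit-self cntL i)) λ ()

      selected : IsSelect cntF n (markedRank L n cntL j) (LF sto L n j)
      selected = select-sound cntF n (correct j 1≤j j≤n (∧-conicalˡ _ _ clj))

      unmark : Before i j ⊎ Before j i
        → IsSelect (clearBit cntF (LF sto L n i)) n (markedRank L n (clearBit cntL i) j) (LF sto L n j)
      unmark (inj₁ i-before-j) =
        isSelect-clearBit-below (LF-monotone i≤n 1≤j i-before-j) (LF-positive 1≤i) cFi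
          (subst (λ t → IsSelect cntF n t (LF sto L n j))
                 (markedRank-clearBit-before cLi 1≤i i≤n i-before-j) selected)
      unmark (inj₂ j-before-i) =
        subst (λ t → IsSelect (clearBit cntF (LF sto L n i)) n t (LF sto L n j))
              (sym (markedRank-clearBit-after j-before-i))
              (isSelect-clearBit-above (LF-monotone j≤n 1≤i j-before-i) selected)

  markedRank-skip : ∀ X a {i} m j → 1 ≤ i → i ≤ suc m → a i ≡ false
    → markedRank (λ k → X (skip i k)) m (λ k → a (skip i k)) j ≡ markedRank X (suc m) a (skip i j)
  markedRank-skip X a {i} m j 1≤i i≤1+m ai = cong₂ _+_
    (count-skip-suc (λ k → a k ∧ ⌊ X k <A? X (skip i j) ⌋) m 1≤i i≤1+m (cong (_∧ _) ai))
    (count-skip (λ k → a k ∧ ⌊ X k ≟A X (skip i j) ⌋) j 1≤i (cong (_∧ _) ai))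

  GenLF-skip : ∀ L cntL cntF n i → 1 ≤ i → i ≤ n → cntL i ≡ false → cntF i ≡ false → ∀ j
    → GenLF sto (λ k → L (skip i k)) (λ k → cntL (skip i k)) (λ k → cntF (skip i k)) (n ∸ 1) j
      ≡ Maybe.map (unskip i) (GenLF sto L cntL cntF n (skip i j))
  GenLF-skip L cntL cntF zero    i 1≤i i≤0 = contradiction (≤-trans 1≤i i≤0) λ ()
  GenLF-skip L cntL cntF (suc n) i 1≤i i≤n cLi cFi j =
    trans (cong (select _ n) (markedRank-skip L cntL n j 1≤i i≤n cLi)) (select-skip cntF n _ 1≤i i≤n cFi)

lemma12 : {A : Set} {_≺_ : A → A → Set} (sto : IsStrictTotalOrder _≡_ _≺_)
    → ($ : A) → (∀ c → ¬ (c ≺ $))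
    → (n : ℕ) (S : ℕ → A) (SA : ℕ → ℕ)
    → Nullterminated sto $ S n → IsSuffixArray sto S n SA
    → (cntL cntF : ℕ → Bool)
    → let L = BWT sto $ S SA in
      ((∀ i → 1 ≤ i → i ≤ n → cntL i ≡ true × cntF i ≡ true)
        → ∀ i → 1 ≤ i → i ≤ n → GenLF sto L cntL cntF n i ≡ just (LF sto L n i))
    × ((∀ j → 1 ≤ j → j ≤ n → cntL j ≡ true → GenLF sto L cntL cntF n j ≡ just (LF sto L n j))
        → ∀ i → 1 ≤ i → i ≤ n → cntL i ≡ true → cntF (LF sto L n i) ≡ true
        → ∀ j → 1 ≤ j → j ≤ n → clearBit cntL i j ≡ true
        → GenLF sto L (clearBit cntL i) (clearBit cntF (LF sto L n i)) n j ≡ just (LF sto L n j))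
    × (∀ i → 1 ≤ i → i ≤ n → cntL i ≡ false → cntF i ≡ false
        → ∀ j → 1 ≤ j → j ≤ n ∸ 1
        → GenLF sto (λ k → L (skip i k)) (λ k → cntL (skip i k)) (λ k → cntF (skip i k)) (n ∸ 1) j
          ≡ Maybe.map (λ p → p ∸ [ i ≤ᵇ p ]) (GenLF sto L cntL cntF n (skip i j)))
lemma12 sto $ _ n S SA _ _ cntL cntF =
    GenLF-allMarked≡LF sto L n
  , GenLF≡LF-clearBit sto L n
  , λ i 1≤i i≤n cLi cFi j _ _ → GenLF-skip sto L cntL cntF n i 1≤i i≤n cLi cFi j
  where L = BWT sto $ S SA
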